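{- Work in intensional Martin-Löf type theory with a cumulative hierarchy of univalent universes. Let $\mathcal{U}$ be a universe, $A:\mathcal{U}$, and $n$ a natural number. Then $$\Omega^{n+2}(\mathcal{U}, A) = \Big(\prod_{a:A} \pi_1\big(\Omega^{n+1}(A,a)\big),\ \lambda a.\,\pi_2\big(\Omega^{n+1}(A,a)\big)\Big),$$ i.e. the $(n+2)$-fold loop space of the universe at $A$ equals the pointed type of dependent functions assigning to each $a:A$ an element of the underlying type of $\Omega^{n+1}(A,a)$, pointed at the function picking each basepoint.
   Context: The ambient theory is intensional Martin-Löf type theory with a cumulative hierarchy of universes $\mathcal{U}_0:\mathcal{U}_1:\dots$, each satisfying univalence; no higher inductive types. "$=$" denotes the identity type between pointed types. A pointed type is a pair $(B,b)$ with $b:B$; $\pi_1,\pi_2$ are the projections. Loop spaces: $\Omega(B,b):\equiv((b=b),\mathsf{refl}_b)$, $\Omega^0(B,b):\equiv(B,b)$, $\Omega^{k+1}(B,b):\equiv\Omega^k(\Omega(B,b))$. -}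

{-# OPTIONS --without-K #-}
module Defs where

open import Level using (Level; _⊔_) renaming (suc to lsuc)
open import Data.Nat using (ℕ; zero; suc)
open import Data.Product using (Σ; _,_; proj₁; proj₂)
open import Relation.Binary.PropositionalEquality using (_≡_; refl)

isContr : ∀ {ℓ} → Set ℓ → Set ℓ
isContr X = Σ X (λ c → (x : X) → c ≡ x)

fiber : ∀ {ℓ ℓ'} {X : Set ℓ} {Y : Set ℓ'} → (X → Y) → Y → Set (ℓ ⊔ ℓ')
fiber {X = X} f y = Σ X (λ x → f x ≡ y)

isEquiv : ∀ {ℓ ℓ'} {X : Set ℓ} {Y : Set ℓ'} → (X → Y) → Set (ℓ ⊔ ℓ')
isEquiv {Y = Y} f = (y : Y) → isContr (fiber f y)

_≃_ : ∀ {ℓ ℓ'} → Set ℓ → Set ℓ' → Set (ℓ ⊔ ℓ')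
X ≃ Y = Σ (X → Y) isEquiv

idEquiv : ∀ {ℓ} (X : Set ℓ) → X ≃ X
idEquiv X = (λ x → x) , λ y → (y , refl) , λ { (x , refl) → refl }

idtoeqv : ∀ {ℓ} {X Y : Set ℓ} → X ≡ Y → X ≃ Y
idtoeqv {X = X} refl = idEquiv X

Univalence : (ℓ : Level) → Set (lsuc ℓ)
Univalence ℓ = (X Y : Set ℓ) → isEquiv (idtoeqv {ℓ} {X} {Y})

Pointed : (ℓ : Level) → Set (lsuc ℓ)
Pointed ℓ = Σ (Set ℓ) (λ B → B)

Ω : ∀ {ℓ} → Pointed ℓ → Pointed ℓ
Ω (B , b) = (b ≡ b) , refl

Ω^ : ∀ {ℓ} → ℕ → Pointed ℓ → Pointed ℓ
Ω^ zero X = X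
Ω^ (suc k) X = Ω^ k (Ω X)

{-# OPTIONS --without-K #-}

-- Univalence identifies Ω(𝒰, A) with the automorphisms (A ≃ A, id).  Being an
-- equivalence is a proposition, so a loop at id in A ≃ A is a loop at id in
-- A → A, i.e. (by function extensionality, itself a consequence of univalence)
-- an element of Π a. Ω(A, a).  Loop spaces commute with dependent products and
-- with universe lifting, so the remaining n loop spaces can be taken pointwise.

module Submission where

open import Defs
open import Level using (Level; Lift; lift; lower; _⊔_) renaming (suc to lsuc)
open import Data.Nat using (ℕ; zero; suc; _+_)
open import Data.Product using (Σ; _,_; proj₁; proj₂)
open import Data.Product.Properties using (Σ-≡,≡→≡; Σ-≡,≡↔≡)
open import Function.Base using (id; _∘_)
open import Function.Bundles using (Inverse; _↔_; mk↔ₛ′)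
open import Function.Properties.Inverse using (↔-sym; ↔-trans)
open import Function.Properties.Inverse.HalfAdjointEquivalence as HalfAdjoint using (↔⇒≃)
open import Relation.Binary.PropositionalEquality
  using (_≡_; refl; sym; trans; cong; cong-app; subst; module ≡-Reasoning)
open import Relation.Binary.PropositionalEquality.Properties
  using (trans-symˡ)

private variable
  a b c : Level

subst-≡ʳ : {X : Set a} {Y : Set b} (f : X → Y) {x x′ : X} {y : Y}
  (q : x ≡ x′) (u : f x ≡ y) → subst (λ z → f z ≡ y) q u ≡ trans (sym (cong f q)) u
subst-≡ʳ f refl u = refl

-- The half-adjoint coherence is exactly what makes the fibres contractible.
↔⇒isEquiv : {X : Set a} {Y : Set b} (e : X ↔ Y) → isEquiv (Inverse.to e)
↔⇒isEquiv e y = (from y , right-inverse-of y) , contract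
  where
  open HalfAdjoint._≃_ (↔⇒≃ e)
  contract : ∀ {y} (w : fiber to y) → (from y , right-inverse-of y) ≡ w
  contract (x , refl) = Σ-≡,≡→≡ (left-inverse-of x , (begin
    subst (λ z → to z ≡ to x) (left-inverse-of x) (right-inverse-of (to x))
      ≡⟨ subst-≡ʳ to (left-inverse-of x) _ ⟩
    trans (sym (cong to (left-inverse-of x))) (right-inverse-of (to x))
      ≡⟨ cong (trans _) (sym (left-right x)) ⟩
    trans (sym (cong to (left-inverse-of x))) (cong to (left-inverse-of x))
      ≡⟨ trans-symˡ (cong to (left-inverse-of x)) ⟩
    refl ∎))
    where open ≡-Reasoning

isEquiv⇒↔ : {X : Set a} {Y : Set b} {f : X → Y} → isEquiv f → X ↔ Y
isEquiv⇒↔ {f = f} e = mk↔ₛ′ f (λ y → proj₁ (proj₁ (e y)))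
  (λ y → proj₂ (proj₁ (e y))) (λ x → cong proj₁ (proj₂ (e (f x)) (x , refl)))

Lift↔ : {X : Set a} → Lift b X ↔ X
Lift↔ = mk↔ₛ′ lower lift (λ _ → refl) (λ _ → refl)

singleton-isContr : {X : Set a} (x : X) → isContr (Σ X (x ≡_))
singleton-isContr x = (x , refl) , λ { (_ , refl) → refl }

retract-isContr : {X : Set a} {Y : Set b} (r : X → Y) (s : Y → X) →
  (∀ y → r (s y) ≡ y) → isContr X → isContr Y
retract-isContr r s rs (c , h) = r c , λ y → trans (cong r (h (s y))) (rs y)

Σ-isContr↔ : {X : Set a} {B : X → Set b} → (∀ x → isContr (B x)) → Σ X B ↔ X
Σ-isContr↔ cB = mk↔ₛ′ proj₁ (λ x → x , proj₁ (cB x)) (λ _ → refl)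
  (λ { (x , y) → cong (x ,_) (proj₂ (cB x) y) })

isProp : Set a → Set a
isProp X = (x y : X) → x ≡ y

isContr⇒isProp : {X : Set a} → isContr X → isProp X
isContr⇒isProp (c , h) x y = trans (sym (h x)) (h y)

isContr⇒isProp-refl : {X : Set a} (cX : isContr X) (x : X) → isContr⇒isProp cX x x ≡ refl
isContr⇒isProp-refl (c , h) x = trans-symˡ (h x)

isContr-Σ⇒≡↔ : {X : Set a} {Q : X → Set b} {x₀ : X} (φ : ∀ {y} → x₀ ≡ y → Q y) →
  isContr (Σ X Q) → ∀ {y} → (x₀ ≡ y) ↔ Q y
isContr-Σ⇒≡↔ {X = X} {Q} {x₀} φ cΣ {y} = mk↔ₛ′ φ from (λ q → φ-from (path (y , q))) from-φ
  where
  path : (w : Σ X Q) → (x₀ , φ refl) ≡ w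
  path = isContr⇒isProp cΣ (x₀ , φ refl)
  from : Q y → x₀ ≡ y
  from q = cong proj₁ (path (y , q))
  φ-from : ∀ {w} (p : (x₀ , φ refl) ≡ w) → φ (cong proj₁ p) ≡ proj₂ w
  φ-from refl = refl
  from-φ : ∀ {z} (p : x₀ ≡ z) → cong proj₁ (path (z , φ p)) ≡ p
  from-φ refl = cong (cong proj₁) (isContr⇒isProp-refl cΣ (x₀ , φ refl))

subst-id≡idtoeqv : {X Y : Set a} (p : X ≡ Y) (x : X) → subst id p x ≡ proj₁ (idtoeqv p) x
subst-id≡idtoeqv refl x = refl

pointed-≡ : Univalence a → {X Y : Set a} {x : X} {y : Y} (e : X ↔ Y) →
  Inverse.to e x ≡ y → _≡_ {A = Pointed a} (X , x) (Y , y)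
pointed-≡ ua {X} {Y} {x} {y} e ex≡y = Σ-≡,≡→≡ (X≡Y , (begin
  subst id X≡Y x             ≡⟨ subst-id≡idtoeqv X≡Y x ⟩
  proj₁ (idtoeqv X≡Y) x      ≡⟨ cong (λ e′ → proj₁ e′ x) (proj₂ (proj₁ ua-e)) ⟩
  Inverse.to e x             ≡⟨ ex≡y ⟩
  y                          ∎))
  where
  open ≡-Reasoning
  ua-e = ua X Y (Inverse.to e , ↔⇒isEquiv e)
  X≡Y = proj₁ (proj₁ ua-e)

∘-isEquiv : Univalence a → {X Y : Set a} (e : X ≃ Y) (T : Set c) →
  isEquiv (λ (h : T → X) → proj₁ e ∘ h)
∘-isEquiv ua {X} {Y} e T =
  subst (λ e′ → isEquiv (λ (h : T → X) → proj₁ e′ ∘ h)) (proj₂ (proj₁ (ua X Y e)))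
    (∘-idtoeqv-isEquiv (proj₁ (proj₁ (ua X Y e))))
  where
  ∘-idtoeqv-isEquiv : {Z : Set _} (p : X ≡ Z) → isEquiv (λ (h : T → X) → proj₁ (idtoeqv p) ∘ h)
  ∘-idtoeqv-isEquiv refl = proj₂ (idEquiv (T → X))

-- Voevodsky: Π P is a retract of the fibre over id of postcomposition with the
-- equivalence proj₁ : Σ T P → T, and that fibre is contractible.
Π-isContr : Univalence (a ⊔ b) → {T : Set a} {P : T → Set b} →
  (∀ t → isContr (P t)) → isContr ((t : T) → P t)
Π-isContr {b = b} ua {T} {P} cP =
  retract-isContr r (λ f → (λ t → t , f t) , refl) (λ _ → refl)
    (∘-isEquiv ua (Inverse.to proj₁↔ , ↔⇒isEquiv proj₁↔) T lift)
  where
  proj₁↔ : Σ T P ↔ Lift b T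
  proj₁↔ = ↔-trans (Σ-isContr↔ cP) (↔-sym Lift↔)
  r : fiber (λ (h : T → Σ T P) → lift ∘ proj₁ ∘ h) lift → (t : T) → P t
  r (h , q) t = subst P (cong (λ k → lower (k t)) q) (proj₂ (h t))

cong-app↔ : Univalence (a ⊔ b) → {T : Set a} {P : T → Set b} {f g : (t : T) → P t} →
  (f ≡ g) ↔ (∀ t → f t ≡ g t)
cong-app↔ ua {f = f} = isContr-Σ⇒≡↔ cong-app
  (retract-isContr (λ k → proj₁ ∘ k , proj₂ ∘ k) (λ w t → proj₁ w t , proj₂ w t) (λ _ → refl)
    (Π-isContr ua (λ t → singleton-isContr (f t))))

funext : Univalence (a ⊔ b) → {T : Set a} {P : T → Set b} {f g : (t : T) → P t} →
  (∀ t → f t ≡ g t) → f ≡ g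
funext ua = Inverse.from (cong-app↔ ua)

isProp⇒≡-isContr : {X : Set a} → isProp X → (x y : X) → isContr (x ≡ y)
isProp⇒≡-isContr h x y = trans (sym (h x x)) (h x y) , canonical
  where
  canonical : ∀ {z} (p : x ≡ z) → trans (sym (h x x)) (h x z) ≡ p
  canonical refl = trans-symˡ (h x x)

Π-isProp : Univalence (a ⊔ b) → {T : Set a} {P : T → Set b} →
  (∀ t → isProp (P t)) → isProp ((t : T) → P t)
Π-isProp ua pP f g = funext ua (λ t → pP t (f t) (g t))

isContr-isProp : Univalence a → {X : Set a} → isProp (isContr X)
isContr-isProp ua cX@(c , h) (c′ , h′) = Σ-≡,≡→≡ (h c′ ,
  Π-isProp ua (λ x → isContr⇒isProp (isProp⇒≡-isContr (isContr⇒isProp cX) c′ x)) _ h′)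

isEquiv-isProp : Univalence (a ⊔ b) → {X : Set a} {Y : Set b} (f : X → Y) → isProp (isEquiv f)
isEquiv-isProp ua f = Π-isProp ua (λ y → isContr-isProp ua)

Σ-isProp-≡↔ : {X : Set a} {B : X → Set b} → (∀ x → isProp (B x)) →
  {u v : Σ X B} → (u ≡ v) ↔ (proj₁ u ≡ proj₁ v)
Σ-isProp-≡↔ pB = ↔-trans (↔-sym Σ-≡,≡↔≡) (Σ-isContr↔ (λ p → isProp⇒≡-isContr (pB _) _ _))

Lift∙ : {ℓ : Level} (m : Level) → Pointed ℓ → Pointed (ℓ ⊔ m)
Lift∙ m (X , x) = Lift m X , lift x

Π∙ : {ℓ : Level} {A : Set ℓ} → (A → Pointed ℓ) → Pointed ℓ
Π∙ {A = A} P = ((a : A) → proj₁ (P a)) , (λ a → proj₂ (P a))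

lift-≡↔ : {X : Set a} {x y : X} → (lift {ℓ = b} x ≡ lift y) ↔ Lift b (x ≡ y)
lift-≡↔ = mk↔ₛ′ (λ p → lift (cong lower p)) (λ q → cong lift (lower q))
  (λ { (lift q) → cong lift (cong-lower-lift q) }) cong-lift-lower
  where
  cong-lower-lift : ∀ {x y} (q : x ≡ y) → cong lower (cong lift q) ≡ q
  cong-lower-lift refl = refl
  cong-lift-lower : ∀ {u v} (p : u ≡ v) → cong lift (cong lower p) ≡ p
  cong-lift-lower refl = refl

Ω-Lift∙ : {ℓ : Level} (m : Level) → Univalence (ℓ ⊔ m) → (X : Pointed ℓ) →
  Ω (Lift∙ m X) ≡ Lift∙ m (Ω X)
Ω-Lift∙ m ua X = pointed-≡ ua lift-≡↔ refl

Ω-Π∙ : {ℓ : Level} → Univalence ℓ → {A : Set ℓ} (P : A → Pointed ℓ) →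
  Ω (Π∙ P) ≡ Π∙ (Ω ∘ P)
Ω-Π∙ ua P = pointed-≡ ua (cong-app↔ ua) refl

Ω^-Lift∙ : {ℓ : Level} (m : Level) → Univalence (ℓ ⊔ m) → (k : ℕ) (X : Pointed ℓ) →
  Ω^ k (Lift∙ m X) ≡ Lift∙ m (Ω^ k X)
Ω^-Lift∙ m ua zero X = refl
Ω^-Lift∙ m ua (suc k) X = trans (cong (Ω^ k) (Ω-Lift∙ m ua X)) (Ω^-Lift∙ m ua k (Ω X))

Ω^-Π∙ : {ℓ : Level} → Univalence ℓ → {A : Set ℓ} (k : ℕ) (P : A → Pointed ℓ) →
  Ω^ k (Π∙ P) ≡ Π∙ (Ω^ k ∘ P)
Ω^-Π∙ ua zero P = refl
Ω^-Π∙ ua (suc k) P = trans (cong (Ω^ k) (Ω-Π∙ ua P)) (Ω^-Π∙ ua k (Ω ∘ P))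

Ω-universe : {ℓ : Level} → Univalence ℓ → Univalence (lsuc ℓ) → (A : Set ℓ) →
  Ω (Set ℓ , A) ≡ Lift∙ (lsuc ℓ) ((A ≃ A) , idEquiv A)
Ω-universe ua ua⁺ A = pointed-≡ ua⁺ (↔-trans (isEquiv⇒↔ (ua A A)) (↔-sym Lift↔)) refl

Ω-≃ : {ℓ : Level} → Univalence ℓ → {X Y : Set ℓ} (e : X ≃ Y) →
  Ω ((X ≃ Y) , e) ≡ Π∙ (λ x → Ω (Y , proj₁ e x))
Ω-≃ ua e = pointed-≡ ua (↔-trans (Σ-isProp-≡↔ (isEquiv-isProp ua)) (cong-app↔ ua)) refl

lemma5p2 : (ua : (ℓ' : Level) → Univalence ℓ') {ℓ : Level} (A : Set ℓ) (n : ℕ) →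
    Ω^ (2 + n) (Set ℓ , A)
      ≡ (Lift _ ((a : A) → proj₁ (Ω^ (1 + n) (A , a))) , lift (λ a → proj₂ (Ω^ (1 + n) (A , a))))
lemma5p2 ua {ℓ} A n = begin
  Ω^ (1 + n) (Ω (Set ℓ , A))
    ≡⟨ cong (Ω^ (1 + n)) (Ω-universe (ua ℓ) (ua (lsuc ℓ)) A) ⟩
  Ω^ (1 + n) (Lift∙ (lsuc ℓ) ((A ≃ A) , idEquiv A))
    ≡⟨ Ω^-Lift∙ (lsuc ℓ) (ua (lsuc ℓ)) (1 + n) _ ⟩
  Lift∙ (lsuc ℓ) (Ω^ n (Ω ((A ≃ A) , idEquiv A)))
    ≡⟨ cong (Lift∙ (lsuc ℓ) ∘ Ω^ n) (Ω-≃ (ua ℓ) (idEquiv A)) ⟩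
  Lift∙ (lsuc ℓ) (Ω^ n (Π∙ (λ a → Ω (A , a))))
    ≡⟨ cong (Lift∙ (lsuc ℓ)) (Ω^-Π∙ (ua ℓ) n _) ⟩
  Lift∙ (lsuc ℓ) (Π∙ (λ a → Ω^ (1 + n) (A , a)))
    ∎
  where open ≡-Reasoning
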